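{- For every crowded subset $X\subseteq\mathbb Q^+$ that is unbounded above, there exists a function $f_X:\omega\to\omega$ such that for every strictly increasing $g:\omega\to\omega$ with $g\not\leq^* f_X$, the set $X(g)$ is crowded and unbounded above (and hence perfect and unbounded).
   Context: $\mathbb Q^+$ is the set of positive rationals with the Euclidean subspace topology; crowded means having no isolated points, perfect means closed and crowded. Fix an effective enumeration $\{q_n\mid n<\omega\}$ of $\mathbb Q^+$. For $f:\omega\to\omega$ and $n<\omega$, let $J_n^f=\{q\in\mathbb Q^+: q_n-\frac{\sqrt2}{k}<q<q_n+\frac{\sqrt2}{k}\}$ where $k$ is the least positive natural number such that $q_m\notin J_n^f$ for every $m\neq n$ with $m\leq f(n)$. For $X\subseteq\mathbb Q^+$ let $X(f)=\mathbb Q^+\setminus\bigcup\{J_n^f: q_n\notin X\}$ (a closed subset of $X$). $g\leq^* f$ means $g(n)\leq f(n)$ for all but finitely many $n$. -}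

module Defs where

open import Level using (0ℓ)
open import Data.Nat as ℕ using (ℕ)
open import Data.Integer using (+_)
open import Data.Rational using (ℚ; 0ℚ; _/_; _-_; _*_; _<_; ∣_∣)
open import Data.Product using (Σ; ∃; _×_)
open import Relation.Nullary using (¬_; Dec)
open import Relation.Binary.PropositionalEquality using (_≡_; _≢_)

ℕ→ℚ : ℕ → ℚ
ℕ→ℚ k = + k / 1

2ℚ : ℚ
2ℚ = + 2 / 1

-- Excluded middle (for Set-level propositions); used as a hypothesis
-- because the paper's argument is classical.
ExcludedMiddle : Set₁
ExcludedMiddle = (P : Set) → Dec P

Pos : ℚ → Set
Pos q = 0ℚ < q

record Enumeration : Set where
  field
    enum      : ℕ → ℚ
    enum-pos  : ∀ n → Pos (enum n)
    enum-inj  : ∀ m n → enum m ≡ enum n → m ≡ n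
    enum-surj : ∀ q → Pos q → Σ ℕ (λ n → enum n ≡ q)

Subset : Set₁
Subset = ℚ → Set

SubsetOfPos : Subset → Set
SubsetOfPos X = ∀ q → X q → Pos q

-- q lies in the open interval (c - √2/k, c + √2/k), i.e. (k·(q - c))² < 2
InBall : ℚ → ℕ → ℚ → Set
InBall c k q = (ℕ→ℚ k * (q - c)) * (ℕ→ℚ k * (q - c)) < 2ℚ

module _ (E : Enumeration) where
  open Enumeration E renaming (enum to qₙ)

  GoodK : (ℕ → ℕ) → ℕ → ℕ → Set
  GoodK f n k = ∀ m → m ℕ.≤ f n → m ≢ n → ¬ InBall (qₙ n) k (qₙ m)

  LeastK : (ℕ → ℕ) → ℕ → ℕ → Set
  LeastK f n k = (1 ℕ.≤ k) × GoodK f n k × (∀ k' → 1 ℕ.≤ k' → k' ℕ.< k → ¬ GoodK f n k')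

  InJ : (ℕ → ℕ) → ℕ → ℚ → Set
  InJ f n q = Pos q × Σ ℕ (λ k → LeastK f n k × InBall (qₙ n) k q)

  Xof : Subset → (ℕ → ℕ) → Subset
  Xof X f q = Pos q × (∀ n → ¬ X (qₙ n) → ¬ InJ f n q)

Crowded : Subset → Set
Crowded X = ∀ x → X x → ∀ ε → 0ℚ < ε → Σ ℚ (λ y → X y × (y ≢ x) × (∣ y - x ∣ < ε))

UnboundedAbove : Subset → Set
UnboundedAbove X = ∀ r → Σ ℚ (λ y → X y × (r < y))

StrictlyIncreasing : (ℕ → ℕ) → Set
StrictlyIncreasing g = ∀ m n → m ℕ.< n → g m ℕ.< g n

_≤*_ : (ℕ → ℕ) → (ℕ → ℕ) → Set
g ≤* f = Σ ℕ (λ N → ∀ n → N ℕ.≤ n → g n ℕ.≤ f n)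

module Submission where

-- Because √2/k is irrational, a rational x outside the interval of radius √2/k around c has a whole
-- neighbourhood outside it, and this holds uniformly in k, since only the least such k matters. Hence,
-- X being crowded, for each q_a ∈ X and n it contains points y ≠ q_a within 1/(n+1) of q_a that lie outside
-- every J_i (i < n, q_i ∉ X) which q_a lies outside of; X being unbounded, it also contains a point above n and
-- above q_i + 2 for every i < n. Let f_X(n) bound the indices of these points for a ≤ n. For g(n) > f_X(n)
-- they avoid J_i^g for i ≥ n as well, because their index is below g(n) ≤ g(i); and g ≰* f_X gives
-- infinitely many such n.

open import Defs
open import Data.Nat using (ℕ)
open import Data.Product using (Σ; _×_)
open import Relation.Nullary using (¬_)

open import Data.Nat as ℕ using (zero; suc; s≤s; z≤n)
import Data.Nat.Properties as ℕ
open import Data.Nat.Induction using (<-rec)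
open import Data.Nat.Divisibility as ℕ using (divides)
open import Data.Nat.Primality using (prime?; euclidsLemma)
open import Data.Nat.Coprimality using (Coprime; 1-coprimeTo) renaming (recompute to recomputeCoprime; sym to symCoprime)
import Data.Nat.Solver as ℕ-Solver
open import Data.Integer as ℤ using (+_; -[1+_]; +[1+_]; +<+; +≤+; -≤+)
import Data.Integer.Properties as ℤ
open import Data.Rational
open import Data.Rational.Properties
import Data.Rational.Solver as ℚ-Solver
import Data.Rational.Unnormalised as ℚᵘ
open import Data.Product using (∃; _,_; proj₁; proj₂)
open import Data.Sum using (inj₁; inj₂)
open import Data.Empty using (⊥-elim)
open import Relation.Nullary using (Dec; yes; no; ¬?)
open import Relation.Nullary.Decidable using (decidable-stable; from-yes)
open import Relation.Unary using (Decidable)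
open import Relation.Binary.PropositionalEquality
open import Function using (_∘_)

least-witness : {P : ℕ → Set} → Decidable P → ∀ k → P k →
  ∃ λ k₀ → P k₀ × (∀ j → j ℕ.< k₀ → ¬ P j)
least-witness {P} P? = <-rec (λ k → P k → Least) go
  where
  Least : Set
  Least = ∃ λ k₀ → P k₀ × (∀ j → j ℕ.< k₀ → ¬ P j)
  go : ∀ k → (∀ {j} → j ℕ.< k → P j → Least) → P k → Least
  go k smaller pk with ℕ.anyUpTo? P? k
  ... | yes (j , j<k , pj) = smaller j<k pj
  ... | no none            = k , pk , λ j j<k pj → none (j , j<k , pj)

∀<-suc : ∀ {P : ℕ → Set} {n} → (∀ i → i ℕ.< n → P i) → P n → ∀ i → i ℕ.< suc n → P i
∀<-suc {n = n} below at i (s≤s i≤n) with ℕ.m≤n⇒m<n∨m≡n i≤n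
... | inj₁ i<n  = below i i<n
... | inj₂ refl = at

strictlyIncreasing⇒monotone : ∀ {g} → StrictlyIncreasing g → ∀ {m n} → m ℕ.≤ n → g m ℕ.≤ g n
strictlyIncreasing⇒monotone {g} g↑ {m} m≤n with ℕ.m≤n⇒m<n∨m≡n m≤n
... | inj₁ m<n  = ℕ.<⇒≤ (g↑ m _ m<n)
... | inj₂ refl = ℕ.≤-refl

¬≤*⇒frequently-> : ExcludedMiddle → ∀ {g f} → ¬ (g ≤* f) → ∀ N → ∃ λ n → N ℕ.≤ n × f n ℕ.< g n
¬≤*⇒frequently-> lem {g} {f} g≰*f N = decidable-stable (lem _) λ never →
  g≰*f (N , λ n N≤n → ℕ.≮⇒≥ λ fn<gn → never (n , N≤n , fn<gn))

maxUpTo : (ℕ → ℕ) → ℕ → ℕ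
maxUpTo h zero    = h zero
maxUpTo h (suc n) = maxUpTo h n ℕ.⊔ h (suc n)

≤-maxUpTo : ∀ h {a n} → a ℕ.≤ n → h a ℕ.≤ maxUpTo h n
≤-maxUpTo h {n = zero}  z≤n = ℕ.≤-refl
≤-maxUpTo h {a} {suc n} a≤1+n = ∀<-suc {λ a → h a ℕ.≤ maxUpTo h (suc n)}
  (λ a a<1+n → ℕ.≤-trans (≤-maxUpTo h (ℕ.≤-pred a<1+n)) (ℕ.m≤m⊔n (maxUpTo h n) (h (suc n))))
  (ℕ.m≤n⊔m (maxUpTo h n) (h (suc n))) a (s≤s a≤1+n)

ℕ→ℚ≡mkℚ : ∀ k → ℕ→ℚ k ≡ mkℚ (+ k) 0 (symCoprime (1-coprimeTo k))
ℕ→ℚ≡mkℚ k = ↥p/↧p≡p (mkℚ (+ k) 0 (symCoprime (1-coprimeTo k)))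

ℕ→ℚ-mono-≤ : ∀ {j k} → j ℕ.≤ k → ℕ→ℚ j ≤ ℕ→ℚ k
ℕ→ℚ-mono-≤ {j} {k} j≤k rewrite ℕ→ℚ≡mkℚ j | ℕ→ℚ≡mkℚ k =
  *≤* (subst₂ ℤ._≤_ (sym (ℤ.*-identityʳ (+ j))) (sym (ℤ.*-identityʳ (+ k))) (+≤+ j≤k))

ℕ→ℚ-nonNeg : ∀ k → 0ℚ ≤ ℕ→ℚ k
ℕ→ℚ-nonNeg k = ℕ→ℚ-mono-≤ {0} {k} z≤n

ℕ→ℚ-suc-pos : ∀ k → 0ℚ < ℕ→ℚ (suc k)
ℕ→ℚ-suc-pos k rewrite ℕ→ℚ≡mkℚ (suc k) =
  *<* (subst (+ 0 ℤ.<_) (sym (ℤ.*-identityʳ (+ suc k))) (+<+ (s≤s z≤n)))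

∣ℕ→ℚ*p∣ : ∀ k p → ∣ ℕ→ℚ k * p ∣ ≡ ℕ→ℚ k * ∣ p ∣
∣ℕ→ℚ*p∣ k p rewrite ∣p*q∣≡∣p∣*∣q∣ (ℕ→ℚ k) p | 0≤p⇒∣p∣≡p (ℕ→ℚ-nonNeg k) = refl

archimedean : ∀ r → ∃ λ N → r < ℕ→ℚ N
archimedean (mkℚ i d c) = N , subst (mkℚ i d c <_) (sym (ℕ→ℚ≡mkℚ N)) (*<* i*1<N*d)
  where
  N : ℕ
  N = suc ℤ.∣ i ∣
  i≤∣i∣ : ∀ i → i ℤ.≤ + ℤ.∣ i ∣
  i≤∣i∣ (+ n)    = ℤ.≤-refl
  i≤∣i∣ -[1+ n ] = -≤+
  i*1<N*d : i ℤ.* + 1 ℤ.< + N ℤ.* + suc d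
  i*1<N*d = subst₂ ℤ._<_ (sym (ℤ.*-identityʳ i)) (ℤ.pos-* N (suc d))
    (ℤ.≤-<-trans (i≤∣i∣ i) (+<+ (ℕ.<-≤-trans (ℕ.n<1+n ℤ.∣ i ∣) (ℕ.m≤m*n N (suc d)))))

1/suc : ℕ → ℚ
1/suc n = mkℚ (+ 1) n (1-coprimeTo (suc n))

1/suc-pos : ∀ n → 0ℚ < 1/suc n
1/suc-pos n = *<* (+<+ (s≤s z≤n))

1/suc-eventually-≤ : ∀ ε → 0ℚ < ε → ∃ λ N → ∀ n → N ℕ.≤ n → 1/suc n ≤ ε
1/suc-eventually-≤ (mkℚ +[1+ p ] d c) _ = d , λ n d≤n →
  *≤* (subst₂ ℤ._≤_ (ℤ.pos-* 1 (suc d)) (ℤ.pos-* (suc p) (suc n))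
    (+≤+ (ℕ.≤-trans (ℕ.≤-reflexive (ℕ.*-identityˡ (suc d))) (ℕ.≤-trans (s≤s d≤n) (ℕ.m≤n*m (suc n) (suc p))))))
1/suc-eventually-≤ (mkℚ (+ 0) d c) (*<* (+<+ ()))
1/suc-eventually-≤ (mkℚ -[1+ p ] d c) (*<* ())

≤⇒≯ : ∀ {p q} → p ≤ q → ¬ (q < p)
≤⇒≯ p≤q q<p = <-irrefl refl (≤-<-trans p≤q q<p)

⊓-pos : ∀ p q → 0ℚ < p → 0ℚ < q → 0ℚ < p ⊓ q
⊓-pos p q 0<p 0<q with ⊓-sel p q
... | inj₁ p⊓q≡p = subst (0ℚ <_) (sym p⊓q≡p) 0<p
... | inj₂ p⊓q≡q = subst (0ℚ <_) (sym p⊓q≡q) 0<q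

square≡square-∣∣ : ∀ p → p * p ≡ ∣ p ∣ * ∣ p ∣
square≡square-∣∣ p with ∣p∣≡p∨∣p∣≡-p p
... | inj₁ ∣p∣≡p rewrite ∣p∣≡p = refl
... | inj₂ ∣p∣≡-p rewrite ∣p∣≡-p = solve 1 (λ p → p :* p := (:- p) :* (:- p)) refl p
  where open ℚ-Solver.+-*-Solver

square-mono-∣∣ : ∀ {p q} → ∣ p ∣ ≤ ∣ q ∣ → p * p ≤ q * q
square-mono-∣∣ {p} {q} ∣p∣≤∣q∣ rewrite square≡square-∣∣ p | square≡square-∣∣ q =
  ≤-trans (*-monoʳ-≤-nonNeg ∣ p ∣ {{∣-∣-nonNeg p}} ∣p∣≤∣q∣) (*-monoˡ-≤-nonNeg ∣ q ∣ {{∣-∣-nonNeg q}} ∣p∣≤∣q∣)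

-∣p∣≤p : ∀ p → - ∣ p ∣ ≤ p
-∣p∣≤p p with ∣p∣≡p∨∣p∣≡-p p
... | inj₁ ∣p∣≡p  = ≤-trans (neg-antimono-≤ (0≤∣p∣ p)) (subst (0ℚ ≤_) ∣p∣≡p (0≤∣p∣ p))
... | inj₂ ∣p∣≡-p = ≤-reflexive (trans (cong -_ ∣p∣≡-p) (solve 1 (λ p → :- (:- p) := p) refl p))
  where open ℚ-Solver.+-*-Solver

-- Irrationality of √2

2∣-square⇒2∣ : ∀ m → 2 ℕ.∣ m ℕ.* m → 2 ℕ.∣ m
2∣-square⇒2∣ m 2∣m*m with euclidsLemma m m (from-yes (prime? 2)) 2∣m*m
... | inj₁ 2∣m = 2∣m
... | inj₂ 2∣m = 2∣m

coprime-square≢2*square : ∀ m d → Coprime m d → m ℕ.* m ≢ 2 ℕ.* (d ℕ.* d)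
coprime-square≢2*square m d cop m²≡2d² with 2∣-square⇒2∣ m (divides (d ℕ.* d) (trans m²≡2d² (ℕ.*-comm 2 (d ℕ.* d))))
... | divides a refl = 2≢1 (cop (divides a refl , 2∣-square⇒2∣ d (divides (a ℕ.* a) d²≡2a²)))
  where
  open ℕ-Solver.+-*-Solver
  d²≡2a² : d ℕ.* d ≡ (a ℕ.* a) ℕ.* 2
  d²≡2a² = ℕ.*-cancelˡ-≡ (d ℕ.* d) ((a ℕ.* a) ℕ.* 2) 2 (trans (sym m²≡2d²)
    (solve 1 (λ a → (a :* con 2) :* (a :* con 2) := con 2 :* ((a :* a) :* con 2)) refl a))
  2≢1 : 2 ≢ 1
  2≢1 ()

square≢2 : ∀ r → r * r ≢ 2ℚ
square≢2 r@(mkℚ n d c) r²≡2 with subst (λ z → toℚᵘ z ℚᵘ.≃ toℚᵘ r ℚᵘ.* toℚᵘ r) r²≡2 (toℚᵘ-homo-* r r)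
... | ℚᵘ.*≡* eq = coprime-square≢2*square ℤ.∣ n ∣ (suc d) (recomputeCoprime c) (sym (begin
  2 ℕ.* (suc d ℕ.* suc d)             ≡⟨ ℤ.abs-* (+ 2) (+ (suc d ℕ.* suc d)) ⟨
  ℤ.∣ + 2 ℤ.* + (suc d ℕ.* suc d) ∣   ≡⟨ cong ℤ.∣_∣ eq ⟩
  ℤ.∣ (n ℤ.* n) ℤ.* + 1 ∣             ≡⟨ cong ℤ.∣_∣ (ℤ.*-identityʳ (n ℤ.* n)) ⟩
  ℤ.∣ n ℤ.* n ∣                       ≡⟨ ℤ.abs-* n n ⟩
  ℤ.∣ n ∣ ℕ.* ℤ.∣ n ∣                 ∎))
  where open ≡-Reasoning

-- Neighbourhoods in ℚ

Near : ℚ → (ℚ → Set) → Set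
Near x P = ∃ λ η → 0ℚ < η × ∀ y → ∣ y - x ∣ < η → P y

near-always : ∀ {x P} → (∀ y → P y) → Near x P
near-always P-all = 1ℚ , from-yes (0ℚ <? 1ℚ) , λ y _ → P-all y

near-ball : ∀ x {ε} → 0ℚ < ε → Near x (λ y → ∣ y - x ∣ < ε)
near-ball x {ε} 0<ε = ε , 0<ε , λ _ close → close

near-mono : ∀ {x P Q} → (∀ {y} → P y → Q y) → Near x P → Near x Q
near-mono P⇒Q (η , 0<η , near) = η , 0<η , λ y close → P⇒Q (near y close)

near-× : ∀ {x P Q} → Near x P → Near x Q → Near x (λ y → P y × Q y)
near-× (η , 0<η , nearP) (θ , 0<θ , nearQ) = η ⊓ θ , ⊓-pos η θ 0<η 0<θ ,
  λ y close → nearP y (<-≤-trans close (p⊓q≤p η θ)) , nearQ y (<-≤-trans close (p⊓q≤q η θ))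

near-∀< : ∀ {x} {P : ℕ → ℚ → Set} n → (∀ i → i ℕ.< n → Near x (P i)) →
  Near x (λ y → ∀ i → i ℕ.< n → P i y)
near-∀< zero    _      = near-always λ _ _ ()
near-∀< (suc n) near-i = near-mono (λ (below , at) → ∀<-suc below at)
  (near-× (near-∀< n λ i i<n → near-i i (ℕ.m≤n⇒m≤1+n i<n)) (near-i n ℕ.≤-refl))

near-affine : ∀ {x Q} K c .{{_ : Positive K}} → Near (K * (x - c)) Q → Near x (λ y → Q (K * (y - c)))
near-affine {x} K c (η , 0<η , near) = η * 1/K , 0<η/K , λ y close → near (K * (y - c)) (begin-strict
  ∣ K * (y - c) - K * (x - c) ∣  ≡⟨ cong ∣_∣ (solve 4 (λ K c x y → K :* (y :- c) :- K :* (x :- c) := K :* (y :- x)) refl K c x y) ⟩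
  ∣ K * (y - x) ∣    ≡⟨ ∣p*q∣≡∣p∣*∣q∣ K (y - x) ⟩
  ∣ K ∣ * ∣ y - x ∣  ≡⟨ cong (_* ∣ y - x ∣) (0≤p⇒∣p∣≡p (<⇒≤ (positive⁻¹ K))) ⟩
  K * ∣ y - x ∣      <⟨ *-monoʳ-<-pos K close ⟩
  K * (η * 1/K)      ≡⟨ solve 3 (λ K η i → K :* (η :* i) := η :* (i :* K)) refl K η 1/K ⟩
  η * (1/K * K)      ≡⟨ cong (η *_) (*-inverseˡ K) ⟩
  η * 1ℚ             ≡⟨ *-identityʳ η ⟩
  η                  ∎)
  where
  open ℚ-Solver.+-*-Solver
  open ≤-Reasoning
  instance
    K≢0 : NonZero K
    K≢0 = pos⇒nonZero K
  1/K : ℚ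
  1/K = 1/ K
  0<η/K : 0ℚ < η * 1/K
  0<η/K = positive⁻¹ _ {{pos*pos⇒pos η {{positive 0<η}} 1/K {{1/pos⇒pos K}}}}

square-near-≥ : ∀ u {s} → 0ℚ < s → Near u (λ w → u * u - s ≤ w * w)
square-near-≥ u {s} 0<s = δ , 0<δ , λ w close → begin
  u * u - s                      ≤⟨ +-monoʳ-≤ (u * u) (neg-antimono-≤ (cross-term-bound w close)) ⟩
  u * u - ∣ (w - u) * (u + w) ∣  ≤⟨ +-monoʳ-≤ (u * u) (-∣p∣≤p ((w - u) * (u + w))) ⟩
  u * u + (w - u) * (u + w)      ≡⟨ solve 2 (λ u w → u :* u :+ (w :- u) :* (u :+ w) := w :* w) refl u w ⟩
  w * w                          ∎
  where
  open ℚ-Solver.+-*-Solver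
  open ≤-Reasoning
  A : ℚ
  A = ∣ u ∣ + ∣ u ∣ + 1ℚ
  instance
    A-pos : Positive A
    A-pos = nonNeg+pos⇒pos (∣ u ∣ + ∣ u ∣) {{nonNeg+nonNeg⇒nonNeg (∣ u ∣) {{∣-∣-nonNeg u}} (∣ u ∣) {{∣-∣-nonNeg u}}}} 1ℚ
    A≢0 : NonZero A
    A≢0 = pos⇒nonZero A
  δ : ℚ
  δ = 1ℚ ⊓ (s * 1/ A)
  0<δ : 0ℚ < δ
  0<δ = ⊓-pos 1ℚ (s * 1/ A) (from-yes (0ℚ <? 1ℚ)) (positive⁻¹ _ {{pos*pos⇒pos s {{positive 0<s}} (1/ A) {{1/pos⇒pos A}}}})
  cross-term-bound : ∀ w → ∣ w - u ∣ < δ → ∣ (w - u) * (u + w) ∣ ≤ s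
  cross-term-bound w close = begin
    ∣ (w - u) * (u + w) ∣          ≡⟨ ∣p*q∣≡∣p∣*∣q∣ (w - u) (u + w) ⟩
    ∣ w - u ∣ * ∣ u + w ∣          ≤⟨ *-monoˡ-≤-nonNeg ∣ w - u ∣ {{∣-∣-nonNeg (w - u)}} ∣u+w∣≤A ⟩
    ∣ w - u ∣ * A                  ≤⟨ *-monoʳ-≤-nonNeg A {{pos⇒nonNeg A}} (<⇒≤ (<-≤-trans close (p⊓q≤q 1ℚ (s * 1/ A)))) ⟩
    s * 1/ A * A                   ≡⟨ *-assoc s (1/ A) A ⟩
    s * (1/ A * A)                 ≡⟨ cong (s *_) (*-inverseˡ A) ⟩
    s * 1ℚ                         ≡⟨ *-identityʳ s ⟩
    s                              ∎
    where
    ∣u+w∣≤A : ∣ u + w ∣ ≤ A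
    ∣u+w∣≤A = begin
      ∣ u + w ∣                    ≡⟨ cong ∣_∣ (solve 2 (λ u w → u :+ w := (u :+ u) :+ (w :- u)) refl u w) ⟩
      ∣ (u + u) + (w - u) ∣        ≤⟨ ∣p+q∣≤∣p∣+∣q∣ (u + u) (w - u) ⟩
      ∣ u + u ∣ + ∣ w - u ∣        ≤⟨ +-mono-≤ (∣p+q∣≤∣p∣+∣q∣ u u) (<⇒≤ (<-≤-trans close (p⊓q≤p 1ℚ (s * 1/ A)))) ⟩
      A                            ∎

-- Balls of radius √2/k

InBall-zero : ∀ c x → InBall c 0 x
InBall-zero c x = subst (λ z → z * z < 2ℚ) (sym (*-zeroˡ (x - c))) (from-yes (0ℚ * 0ℚ <? 2ℚ))

InBall-centre : ∀ c k → InBall c k c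
InBall-centre c k rewrite +-inverseʳ c | *-zeroʳ (ℕ→ℚ k) = from-yes (0ℚ * 0ℚ <? 2ℚ)

2≤∣scaled∣⇒¬InBall : ∀ {c k x} → 2ℚ ≤ ∣ ℕ→ℚ k * (x - c) ∣ → ¬ InBall c k x
2≤∣scaled∣⇒¬InBall 2≤∣kd∣ = ≤⇒≯ (≤-trans (from-yes (2ℚ ≤? 2ℚ * 2ℚ)) (square-mono-∣∣ {2ℚ} 2≤∣kd∣))

¬InBall-mono : ∀ {c x j k} → j ℕ.≤ k → ¬ InBall c j x → ¬ InBall c k x
¬InBall-mono {c} {x} {j} {k} j≤k x∉B = ≤⇒≯ (≤-trans (≮⇒≥ x∉B) (square-mono-∣∣ (begin
  ∣ ℕ→ℚ j * (x - c) ∣  ≡⟨ ∣ℕ→ℚ*p∣ j (x - c) ⟩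
  ℕ→ℚ j * ∣ x - c ∣    ≤⟨ *-monoʳ-≤-nonNeg ∣ x - c ∣ {{∣-∣-nonNeg (x - c)}} (ℕ→ℚ-mono-≤ j≤k) ⟩
  ℕ→ℚ k * ∣ x - c ∣    ≡⟨ ∣ℕ→ℚ*p∣ k (x - c) ⟨
  ∣ ℕ→ℚ k * (x - c) ∣  ∎)))
  where open ≤-Reasoning

¬InBall-eventually : ∀ {c x} → x ≢ c → ∃ λ k → ¬ InBall c k x
¬InBall-eventually {c} {x} x≢c = k , 2≤∣scaled∣⇒¬InBall {c} {k} {x} (begin
  2ℚ                      ≡⟨ *-identityʳ 2ℚ ⟨
  2ℚ * 1ℚ                 ≡⟨ cong (2ℚ *_) (*-inverseˡ ∣ x - c ∣) ⟨
  2ℚ * (1/ ∣ x - c ∣ * ∣ x - c ∣)   ≡⟨ *-assoc 2ℚ (1/ ∣ x - c ∣) ∣ x - c ∣ ⟨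
  2ℚ * 1/ ∣ x - c ∣ * ∣ x - c ∣     ≤⟨ *-monoʳ-≤-nonNeg ∣ x - c ∣ {{∣-∣-nonNeg (x - c)}} (<⇒≤ k-large) ⟩
  ℕ→ℚ k * ∣ x - c ∣       ≡⟨ ∣ℕ→ℚ*p∣ k (x - c) ⟨
  ∣ ℕ→ℚ k * (x - c) ∣     ∎)
  where
  open ≤-Reasoning
  open ℚ-Solver.+-*-Solver
  0<∣x-c∣ : 0ℚ < ∣ x - c ∣
  0<∣x-c∣ = ≰⇒> λ ∣x-c∣≤0 → x≢c (begin-equality
    x              ≡⟨ solve 2 (λ x c → x := (x :- c) :+ c) refl x c ⟩
    (x - c) + c    ≡⟨ cong (_+ c) (∣p∣≡0⇒p≡0 (x - c) (≤-antisym ∣x-c∣≤0 (0≤∣p∣ (x - c)))) ⟩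
    0ℚ + c         ≡⟨ +-identityˡ c ⟩
    c              ∎)
  instance
    ∣x-c∣≢0 : NonZero ∣ x - c ∣
    ∣x-c∣≢0 = >-nonZero 0<∣x-c∣
  k : ℕ
  k = proj₁ (archimedean (2ℚ * 1/ ∣ x - c ∣))
  k-large : 2ℚ * 1/ ∣ x - c ∣ < ℕ→ℚ k
  k-large = proj₂ (archimedean (2ℚ * 1/ ∣ x - c ∣))

¬InBall-1 : ∀ {c y} → c + 2ℚ ≤ y → ¬ InBall c 1 y
¬InBall-1 {c} {y} c+2≤y = 2≤∣scaled∣⇒¬InBall {c} {1} {y} (begin
  2ℚ                 ≤⟨ 2≤y-c ⟩
  y - c              ≡⟨ 0≤p⇒∣p∣≡p (≤-trans (from-yes (0ℚ ≤? 2ℚ)) 2≤y-c) ⟨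
  ∣ y - c ∣          ≡⟨ cong ∣_∣ (*-identityˡ (y - c)) ⟨
  ∣ 1ℚ * (y - c) ∣   ∎)
  where
  open ≤-Reasoning
  open ℚ-Solver.+-*-Solver
  2≤y-c : 2ℚ ≤ y - c
  2≤y-c = subst (_≤ y - c) (solve 1 (λ c → (c :+ con 2ℚ) :- c := con 2ℚ) refl c) (+-monoˡ-≤ (- c) c+2≤y)

-- The boundary of a ball has irrational radius √2/k, so it contains no rational.
¬InBall-near : ∀ {c x} k → ¬ InBall c k x → Near x (λ y → ¬ InBall c k y)
¬InBall-near {c} {x} zero    x∉B = ⊥-elim (x∉B (InBall-zero c x))
¬InBall-near {c} {x} (suc k) x∉B =
  near-mono (λ {y} → outside {y}) (near-affine K c (square-near-≥ u 0<u²-2))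
  where
  open ℚ-Solver.+-*-Solver
  K : ℚ
  K = ℕ→ℚ (suc k)
  instance
    K-pos : Positive K
    K-pos = positive (ℕ→ℚ-suc-pos k)
  u : ℚ
  u = K * (x - c)
  2<u² : 2ℚ < u * u
  2<u² = ≰⇒> λ u²≤2 → square≢2 u (≤-antisym u²≤2 (≮⇒≥ x∉B))
  0<u²-2 : 0ℚ < u * u - 2ℚ
  0<u²-2 = +-monoˡ-< (- 2ℚ) 2<u²
  outside : ∀ {y} → u * u - (u * u - 2ℚ) ≤ (K * (y - c)) * (K * (y - c)) → ¬ InBall c (suc k) y
  outside {y} = ≤⇒≯ ∘ subst (_≤ (K * (y - c)) * (K * (y - c)))
                            (solve 1 (λ u → u :* u :- (u :* u :- con 2ℚ) := con 2ℚ) refl u)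

OutsideLike : ℚ → ℚ → ℚ → Set
OutsideLike c x y = ∀ k → ¬ InBall c k x → ¬ InBall c k y

-- Only the least k with x ∉ B(c, √2/k) matters: the balls shrink as k grows.
outsideLike-near : ∀ {c x} → x ≢ c → Near x (OutsideLike c x)
outsideLike-near {c} {x} x≢c = near-mono (λ {y} y∉B₀ k x∉B → ¬InBall-mono {c} {y} (k₀≤ k x∉B) y∉B₀) (¬InBall-near k₀ x∉B₀)
  where
  InBall? : ∀ k → Dec (InBall c k x)
  InBall? k = (ℕ→ℚ k * (x - c)) * (ℕ→ℚ k * (x - c)) <? 2ℚ
  least : ∃ λ k₀ → ¬ InBall c k₀ x × (∀ j → j ℕ.< k₀ → ¬ ¬ InBall c j x)
  least = least-witness (¬? ∘ InBall?) (proj₁ (¬InBall-eventually x≢c)) (proj₂ (¬InBall-eventually x≢c))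
  k₀ : ℕ
  k₀ = proj₁ least
  x∉B₀ : ¬ InBall c k₀ x
  x∉B₀ = proj₁ (proj₂ least)
  k₀≤ : ∀ k → ¬ InBall c k x → k₀ ℕ.≤ k
  k₀≤ k x∉B = ℕ.≮⇒≥ λ k<k₀ → proj₂ (proj₂ least) k k<k₀ x∉B

-- The intervals J_n^f

module _ (E : Enumeration) where
  open Enumeration E renaming (enum to q)

  indexOf : ∀ {y} → Pos y → ℕ
  indexOf {y} y>0 = proj₁ (enum-surj y y>0)

  q-indexOf : ∀ {y} (y>0 : Pos y) → q (indexOf y>0) ≡ y
  q-indexOf {y} y>0 = proj₂ (enum-surj y y>0)

  ¬InBall-eventually-below : ∀ a B → ∃ λ K → ∀ m → m ℕ.< B → m ≢ a → ¬ InBall (q a) K (q m)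
  ¬InBall-eventually-below a zero    = 0 , λ _ ()
  ¬InBall-eventually-below a (suc B) with ¬InBall-eventually-below a B | B ℕ.≟ a
  ... | K , below | yes refl = K , λ m m<1+a m≢a → below m (ℕ.≤∧≢⇒< (ℕ.≤-pred m<1+a) m≢a) m≢a
  ... | K , below | no B≢a   = extend (¬InBall-eventually {q a} {q B} (B≢a ∘ enum-inj B a))
    where
    extend : (∃ λ K′ → ¬ InBall (q a) K′ (q B)) → ∃ λ K → ∀ m → m ℕ.< suc B → m ≢ a → ¬ InBall (q a) K (q m)
    extend (K′ , qB∉B) = K ℕ.⊔ K′ , ∀<-suc {λ m → m ≢ a → ¬ InBall (q a) (K ℕ.⊔ K′) (q m)}
      (λ m m<B m≢a → ¬InBall-mono {q a} {q m} (ℕ.m≤m⊔n K K′) (below m m<B m≢a))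
      (λ _ → ¬InBall-mono {q a} {q B} (ℕ.m≤n⊔m K K′) qB∉B)

  leastK-exists : ExcludedMiddle → ∀ f a → ∃ (LeastK E f a)
  leastK-exists lem f a = least (¬InBall-eventually-below a (suc (f a)))
    where
    least : (∃ λ K → ∀ m → m ℕ.< suc (f a) → m ≢ a → ¬ InBall (q a) K (q m)) → ∃ (LeastK E f a)
    least (K , below) =
      let k , (1≤k , good) , smaller = least-witness (λ k → lem (1 ℕ.≤ k × GoodK E f a k)) (suc K)
            (s≤s z≤n , λ m m≤fa m≢a → ¬InBall-mono {q a} {q m} (ℕ.n≤1+n K) (below m (s≤s m≤fa) m≢a))
      in k , 1≤k , good , λ k′ 1≤k′ k′<k good′ → smaller k′ k′<k (1≤k′ , good′)

  q∈J : ExcludedMiddle → ∀ f a → InJ E f a (q a)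
  q∈J lem f a = let k , least = leastK-exists lem f a in enum-pos a , k , least , InBall-centre (q a) k

  ∉J-if-index≤ : ∀ {f n m} → m ℕ.≤ f n → m ≢ n → ¬ InJ E f n (q m)
  ∉J-if-index≤ m≤fn m≢n (_ , k , (_ , good , _) , qm∈B) = good _ m≤fn m≢n qm∈B

  ∉J-if-2-above : ∀ {f n y} → q n + 2ℚ ≤ y → ¬ InJ E f n y
  ∉J-if-2-above {n = n} {y} qn+2≤y (_ , k , (1≤k , _) , y∈B) = ¬InBall-mono {q n} {y} 1≤k (¬InBall-1 qn+2≤y) y∈B

  ∉J-if-outsideLike : ∀ {f n x y} → Pos x → ¬ InJ E f n x → OutsideLike (q n) x y → ¬ InJ E f n y
  ∉J-if-outsideLike x>0 x∉J outside (_ , k , least , y∈B) =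
    outside k (λ x∈B → x∉J (x>0 , k , least , x∈B)) y∈B

  Xof⊆X : ExcludedMiddle → ∀ X f {x} → Xof E X f x → X x
  Xof⊆X lem X f {x} (x>0 , x∉J) = decidable-stable (lem (X x)) λ ¬Xx →
    x∉J (indexOf x>0) (¬Xx ∘ subst X (q-indexOf x>0))
        (subst (InJ E f (indexOf x>0)) (q-indexOf x>0) (q∈J lem f (indexOf x>0)))

module Construction (lem : ExcludedMiddle) (E : Enumeration) (X : Subset) (X⊆pos : SubsetOfPos X)
                    (X-crowded : Crowded X) (X-unbounded : UnboundedAbove X) where
  open Enumeration E renaming (enum to q)

  Approximates : ℕ → ℕ → ℚ → Set
  Approximates a n y = (∀ i → i ℕ.< n → ¬ X (q i) → OutsideLike (q i) (q a) y) × ∣ y - q a ∣ < 1/suc n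

  approximates-near : ∀ a → X (q a) → ∀ n → Near (q a) (Approximates a n)
  approximates-near a Xqa n = near-× (near-∀< n λ i _ → outside-near i) (near-ball (q a) (1/suc-pos n))
    where
    outside-near : ∀ i → Near (q a) (λ y → ¬ X (q i) → OutsideLike (q i) (q a) y)
    outside-near i with lem (X (q i))
    ... | yes Xqi = near-always λ _ ¬Xqi → ⊥-elim (¬Xqi Xqi)
    ... | no ¬Xqi = near-mono (λ outside _ → outside) (outsideLike-near (¬Xqi ∘ λ qa≡qi → subst X qa≡qi Xqa))

  Approximant : ℕ → ℕ → ℚ → Set
  Approximant a n y = Σ (X y) λ Xy → y ≢ q a × Approximates a n y

  approximant : ∀ a → X (q a) → ∀ n → ∃ (Approximant a n)
  approximant a Xqa n =
    let η , 0<η , near = approximates-near a Xqa n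
        y , Xy , y≢qa , close = X-crowded (q a) Xqa η 0<η
    in y , Xy , y≢qa , near y close

  -- 0 is a dummy value for q a ∉ X, where there is no approximant.
  approximantIndex : ∀ {a} n → Dec (X (q a)) → ℕ
  approximantIndex {a} n (yes Xqa) = indexOf E (X⊆pos _ (proj₁ (proj₂ (approximant a Xqa n))))
  approximantIndex     n (no _)    = 0

  bound : ℕ → ℚ
  bound zero    = 0ℚ
  bound (suc n) = bound n ⊔ (q n + 2ℚ)

  ≤-bound : ∀ {i n} → i ℕ.< n → q i + 2ℚ ≤ bound n
  ≤-bound {i} {suc n} i<1+n = ∀<-suc {λ i → q i + 2ℚ ≤ bound (suc n)}
    (λ i i<n → ≤-trans (≤-bound i<n) (p≤p⊔q (bound n) (q n + 2ℚ))) (p≤q⊔p (bound n) (q n + 2ℚ)) i i<1+n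

  highPoint : ∀ n → ∃ λ y → X y × ℕ→ℚ n ⊔ bound n < y
  highPoint n = X-unbounded (ℕ→ℚ n ⊔ bound n)

  highIndex : ℕ → ℕ
  highIndex n = indexOf E (X⊆pos _ (proj₁ (proj₂ (highPoint n))))

  fX : ℕ → ℕ
  fX n = highIndex n ℕ.⊔ maxUpTo (λ a → approximantIndex n (lem (X (q a)))) n

  highIndex≤fX : ∀ n → highIndex n ℕ.≤ fX n
  highIndex≤fX n = ℕ.m≤m⊔n (highIndex n) _

  approximantIndex≤fX : ∀ {a n} → a ℕ.≤ n → approximantIndex n (lem (X (q a))) ℕ.≤ fX n
  approximantIndex≤fX {n = n} a≤n =
    ℕ.≤-trans (≤-maxUpTo (λ a → approximantIndex n (lem (X (q a)))) a≤n) (ℕ.m≤n⊔m (highIndex n) _)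

  module _ {g : ℕ → ℕ} (g↑ : StrictlyIncreasing g) (g≰*fX : ¬ (g ≤* fX)) where

    ∈Xof-if-index< : ∀ n {y} (Xy : X y) → indexOf E (X⊆pos y Xy) ℕ.< g n →
                     (∀ i → i ℕ.< n → ¬ X (q i) → ¬ InJ E g i y) → Xof E X g y
    ∈Xof-if-index< n {y} Xy index<gn early = X⊆pos y Xy , late-or-early
      where
      q-index≡y : q (indexOf E (X⊆pos y Xy)) ≡ y
      q-index≡y = q-indexOf E (X⊆pos y Xy)
      late-or-early : ∀ i → ¬ X (q i) → ¬ InJ E g i y
      late-or-early i ¬Xqi with n ℕ.≤? i
      ... | no n≰i  = early i (ℕ.≰⇒> n≰i) ¬Xqi
      ... | yes n≤i = subst (¬_ ∘ InJ E g i) q-index≡y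
        (∉J-if-index≤ E {g} (ℕ.<⇒≤ (ℕ.<-≤-trans index<gn (strictlyIncreasing⇒monotone g↑ n≤i)))
                            λ { refl → ¬Xqi (subst X (sym q-index≡y) Xy) })

    approximant-∈Xof : ∀ {a} n → Xof E X g (q a) → approximantIndex n (lem (X (q a))) ℕ.< g n →
                       ∃ λ y → Xof E X g y × y ≢ q a × ∣ y - q a ∣ < 1/suc n
    approximant-∈Xof {a} n qa∈Xof index<gn with lem (X (q a))
    ... | no ¬Xqa = ⊥-elim (¬Xqa (Xof⊆X E lem X g qa∈Xof))
    ... | yes Xqa =
      let y , Xy , y≢qa , outside , close = approximant a Xqa n
      in y , ∈Xof-if-index< n Xy index<gn
               (λ i i<n ¬Xqi → ∉J-if-outsideLike E {g} (proj₁ qa∈Xof) (proj₂ qa∈Xof i ¬Xqi) (outside i i<n ¬Xqi)) ,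
         y≢qa , close

    crowded-at : ∀ a → Xof E X g (q a) → ∀ ε → 0ℚ < ε → ∃ λ y → Xof E X g y × y ≢ q a × ∣ y - q a ∣ < ε
    crowded-at a qa∈Xof ε 0<ε =
      let N , 1/suc≤ε = 1/suc-eventually-≤ ε 0<ε
          n , a⊔N≤n , fXn<gn = ¬≤*⇒frequently-> lem g≰*fX (a ℕ.⊔ N)
          y , y∈Xof , y≢qa , close = approximant-∈Xof n qa∈Xof
            (ℕ.≤-<-trans (approximantIndex≤fX (ℕ.m⊔n≤o⇒m≤o a N a⊔N≤n)) fXn<gn)
      in y , y∈Xof , y≢qa , <-≤-trans close (1/suc≤ε n (ℕ.m⊔n≤o⇒n≤o a N a⊔N≤n))

    crowded : Crowded (Xof E X g)
    crowded x x∈Xof = subst (λ x → ∀ ε → 0ℚ < ε → ∃ λ y → Xof E X g y × y ≢ x × ∣ y - x ∣ < ε) (q-indexOf E x>0)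
      (crowded-at (indexOf E x>0) (subst (Xof E X g) (sym (q-indexOf E x>0)) x∈Xof))
      where
      x>0 : Pos x
      x>0 = proj₁ x∈Xof

    highPoint-∈Xof : ∀ n → fX n ℕ.< g n → Xof E X g (proj₁ (highPoint n))
    highPoint-∈Xof n fXn<gn = ∈Xof-if-index< n (proj₁ (proj₂ (highPoint n))) (ℕ.≤-<-trans (highIndex≤fX n) fXn<gn)
      λ i i<n _ → ∉J-if-2-above E {g} (≤-trans (≤-bound i<n)
                    (≤-trans (p≤q⊔p (ℕ→ℚ n) (bound n)) (<⇒≤ (proj₂ (proj₂ (highPoint n))))))

    unbounded : UnboundedAbove (Xof E X g)
    unbounded r =
      let N , r<N = archimedean r
          n , N≤n , fXn<gn = ¬≤*⇒frequently-> lem g≰*fX N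
      in proj₁ (highPoint n) , highPoint-∈Xof n fXn<gn , (begin-strict
           r                    <⟨ r<N ⟩
           ℕ→ℚ N                ≤⟨ ℕ→ℚ-mono-≤ N≤n ⟩
           ℕ→ℚ n                ≤⟨ p≤p⊔q (ℕ→ℚ n) (bound n) ⟩
           ℕ→ℚ n ⊔ bound n      <⟨ proj₂ (proj₂ (highPoint n)) ⟩
           proj₁ (highPoint n)  ∎)
      where open ≤-Reasoning

lemma3p1 : ExcludedMiddle → (E : Enumeration) → (X : Subset) → SubsetOfPos X →
    Crowded X → UnboundedAbove X →
    Σ (ℕ → ℕ) (λ fX → ∀ (g : ℕ → ℕ) → StrictlyIncreasing g → ¬ (g ≤* fX) →
      Crowded (Xof E X g) × UnboundedAbove (Xof E X g))
lemma3p1 lem E X X⊆pos X-crowded X-unbounded = fX , λ g g↑ g≰*fX → crowded g↑ g≰*fX , unbounded g↑ g≰*fX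
  where open Construction lem E X X⊆pos X-crowded X-unbounded
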